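{- Let $n\geq 3$, $i,j\in[n]$, and $\mathfrak{d}_n=\sum_{k=1}^{n-1}X_k$. If $j>i+1$, then $$\sum_{\sigma\in\mathcal{S}_n^{i,j}}X_{\sigma^{ -1}(i)}\,\mathtt{des_X}(\sigma^{ -1})=\sum_{\sigma\in\mathcal{S}_n^{j,i}}X_{\sigma^{ -1}(j)}\,\mathtt{des_X}(\sigma^{ -1}).$$ If $j=i+1$, then $$\sum_{\sigma\in\mathcal{S}_n^{i,i+1}}X_{\sigma^{ -1}(i)}\,\mathtt{des_X}(\sigma^{ -1})=\sum_{\sigma\in\mathcal{S}_n^{i+1,i}}X_{\sigma^{ -1}(i+1)}\,\mathtt{des_X}(\sigma^{ -1})-X_i\,(n-2)!\,\mathfrak{d}_n.$$
   Context: $\mathcal{S}_n$ is the symmetric group on $[n]$; $\mathtt{des_X}(\sigma)=\sum_{k\in[n-1],\,\sigma(k)>\sigma(k+1)}X_k$. For $a,b\in[n]$, $\mathcal{S}_n^{a,b}=\{\sigma\in\mathcal{S}_n:\sigma^{ -1}(b)-\sigma^{ -1}(a)=1\}$. -}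

module Defs where

open import Level using (Level)
open import Data.Nat using (ℕ; zero; suc; _∸_; _<_)
open import Data.Nat.Properties using (_<?_; _≟_)
open import Data.Fin using (Fin; toℕ; inject₁)
import Data.Fin as Fin
open import Data.Fin.Properties using (all?) renaming (_≟_ to _≟ᶠ_)
open import Data.Fin.Permutation using (Permutation′; permutation; _⟨$⟩ʳ_; _⟨$⟩ˡ_)
open import Data.Product using (_,_)
open import Data.List using (List; []; _∷_; [_]; map; concatMap; filter; foldr)
open import Data.List.Base using (allFin)
open import Data.Vec.Functional using () renaming (_∷_ to _∷ᶠ_)
open import Relation.Nullary using (Dec; yes; no)
open import Relation.Binary.PropositionalEquality using (_≡_)
open import Algebra.Bundles using (CommutativeRing)

allFuns : (m n : ℕ) → List (Fin m → Fin n)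
allFuns zero    n = [ (λ ()) ]
allFuns (suc m) n = concatMap (λ f → map (λ y → y ∷ᶠ f) (allFin n)) (allFuns m n)

-- All permutations of [n] (each appears exactly once: a permutation is
-- determined by the pair (σ, σ⁻¹), and we keep exactly the pairs that are
-- mutually inverse).
allPerms : (n : ℕ) → List (Permutation′ n)
allPerms n = concatMap pick (concatMap (λ f → map (λ g → f , g) (allFuns n n)) (allFuns n n))
  where
  open import Data.Product using (_×_)
  pick : (Fin n → Fin n) × (Fin n → Fin n) → List (Permutation′ n)
  pick (f , g) with all? (λ y → f (g y) ≟ᶠ y) | all? (λ x → g (f x) ≟ᶠ x)
  ... | yes p | yes q = [ permutation f g p q ]
  ... | _     | _     = []

-- S_n^{a,b} = { σ : σ⁻¹(b) - σ⁻¹(a) = 1 }   (positions are 0-based Fin n,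
-- so the difference condition is toℕ σ⁻¹(b) = 1 + toℕ σ⁻¹(a)).
inSab? : ∀ {n} (a b : Fin n) (σ : Permutation′ n) → Dec (toℕ (σ ⟨$⟩ˡ b) ≡ suc (toℕ (σ ⟨$⟩ˡ a)))
inSab? a b σ = toℕ (σ ⟨$⟩ˡ b) ≟ suc (toℕ (σ ⟨$⟩ˡ a))

Sab : (n : ℕ) (a b : Fin n) → List (Permutation′ n)
Sab n a b = filter (inSab? a b) (allPerms n)

module _ {c ℓ : Level} (R : CommutativeRing c ℓ) where
  open CommutativeRing R

  sumR : ∀ {A : Set} → (A → Carrier) → List A → Carrier
  sumR f = foldr (λ a s → f a + s) 0#

  _·ℕ_ : ℕ → Carrier → Carrier
  zero  ·ℕ x = 0#
  suc k ·ℕ x = x + (k ·ℕ x)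

  -- X : ℕ → Carrier gives the variables; X k is X_k (1-based, k ∈ [n-1] used).
  -- des_X(τ) = Σ_{k ∈ [n-1], τ(k) > τ(k+1)} X_k.  A 0-based position p : Fin m
  -- (with n = suc m) compares τ(p) and τ(p+1) and contributes X_{p+1}.
  desX : ∀ {n} → (ℕ → Carrier) → (Fin n → Fin n) → Carrier
  desX {zero}  X τ = 0#
  desX {suc m} X τ = sumR term (allFin m)
    where
    term : Fin m → Carrier
    term p with toℕ (τ (Fin.suc p)) <? toℕ (τ (inject₁ p))
    ... | yes _ = X (suc (toℕ p))
    ... | no  _ = 0#

  dn : ℕ → (ℕ → Carrier) → Carrier
  dn n X = sumR (λ (k : Fin (n ∸ 1)) → X (suc (toℕ k))) (allFin (n ∸ 1))

  -- Σ_{σ ∈ S_n^{a,b}} X_{σ⁻¹(a)} des_X(σ⁻¹)   (σ⁻¹(a) converted to 1-based)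
  sumSab : (n : ℕ) → (ℕ → Carrier) → Fin n → Fin n → Carrier
  sumSab n X a b = sumR (λ σ → X (suc (toℕ (σ ⟨$⟩ˡ a))) * desX X (σ ⟨$⟩ˡ_)) (Sab n a b)

module Submission where

-- Write S(a,b) = Σ_{σ ∈ S_n^{a,b}} X_{σ⁻¹(a)} des_X(σ⁻¹).  Passing to τ = σ⁻¹,
-- S(a,b) is a sum over injections τ : [n] → [n] with τ(b) = τ(a) + 1; splitting
-- by the value q = τ(a), S(a,b) = Σ_q S_q(a,b).  Post-composing τ with the
-- transposition s = (q q+1) of values is a bijection of the injections which
-- turns the constraint (τ(i),τ(j)) = (q,q+1) into (τ(j),τ(i)) = (q,q+1) and
-- changes the descent set only at a position k with {τ(k),τ(k+1)} = {q,q+1}.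
-- If j > i+1 there is no such position, so S_q(i,j) = S_q(j,i).  If j = i+1
-- the only such position is i, where τ has a descent and s∘τ has none; so
-- S_q(i,j) + X_{q+1} X_i · #{τ : τ(j) = q, τ(i) = q+1} = S_q(j,i), and the
-- count is (n-2)!.  Summing over q gives the correction (n-2)! X_i 𝔡_n.

open import Defs
open import Level using (Level)
open import Data.Nat as ℕ using (ℕ; zero; suc; _≤_; _<_; _∸_; _!)
import Data.Nat.Properties as ℕP
open import Data.Fin as F using (Fin; toℕ; inject₁; punchIn; punchOut; _≟_)
open import Data.Fin.Properties
  using (all?; any?; suc-injective; toℕ-injective; toℕ<n; toℕ-inject₁; toℕ-fromℕ; toℕ-fromℕ<;
         punchInᵢ≢i; punchIn-injective; punchIn-punchOut; punchOut-injective; injective⇒≤)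
open import Data.Fin.Permutation using (Permutation′; _⟨$⟩ʳ_; _⟨$⟩ˡ_; inverseˡ; transpose)
import Data.Fin.Permutation.Components as PC
open import Data.List using (List; []; _∷_; _++_; map; concatMap; filter)
open import Data.List.Base using (allFin; tabulate)
open import Data.Product using (Σ; _,_; proj₁; proj₂; ∃; _×_)
open import Data.Sum using (_⊎_; inj₁; inj₂)
open import Data.Empty using (⊥-elim)
open import Data.Vec.Functional using () renaming (_∷_ to _∷ᶠ_)
open import Function using (_∘_; id)
open import Function.Bundles using (_⇔_; mk⇔; Equivalence)
open import Function.Construct.Symmetry using (⇔-sym)
open import Relation.Nullary using (Dec; yes; no; ¬_)
open import Relation.Nullary.Decidable using (_×-dec_; ¬?; _→-dec_)
open import Relation.Binary.PropositionalEquality as P using (_≡_; _≢_)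
open import Algebra.Bundles using (CommutativeRing)

-- Transposing two adjacent values u and v = u+1 preserves the relative order
-- of any two values except u and v themselves.
module AdjacentValues {n : ℕ} (u v : Fin n) (v≡1+u : toℕ v ≡ suc (toℕ u)) where

  t : Fin n → Fin n
  t = PC.transpose u v

  transpose-cases : ∀ k → (k ≡ u × t k ≡ v) ⊎ (k ≡ v × t k ≡ u) ⊎ (k ≢ u × k ≢ v × t k ≡ k)
  transpose-cases k with k ≟ u
  ... | yes k≡u = inj₁ (k≡u , P.refl)
  ... | no k≢u with k ≟ v
  ...   | yes k≡v = inj₂ (inj₁ (k≡v , P.refl))
  ...   | no k≢v  = inj₂ (inj₂ (k≢u , k≢v , P.refl))

  u≢v : u ≢ v
  u≢v u≡v = ℕP.1+n≢n (P.sym (P.trans (P.cong toℕ u≡v) v≡1+u))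

  t-to-u : ∀ y → (t y ≡ u) ⇔ (y ≡ v)
  t-to-u y with transpose-cases y
  ... | inj₁ (y≡u , ty≡v)             = mk⇔ (λ ty≡u → ⊥-elim (u≢v (P.trans (P.sym ty≡u) ty≡v)))
                                            (λ y≡v → ⊥-elim (u≢v (P.trans (P.sym y≡u) y≡v)))
  ... | inj₂ (inj₁ (y≡v , ty≡u))      = mk⇔ (λ _ → y≡v) (λ _ → ty≡u)
  ... | inj₂ (inj₂ (y≢u , y≢v , ty≡y)) = mk⇔ (λ ty≡u → ⊥-elim (y≢u (P.trans (P.sym ty≡y) ty≡u)))
                                            (λ y≡v → ⊥-elim (y≢v y≡v))

  t-to-v : ∀ y → (t y ≡ v) ⇔ (y ≡ u)
  t-to-v y with transpose-cases y
  ... | inj₁ (y≡u , ty≡v)             = mk⇔ (λ _ → y≡u) (λ _ → ty≡v)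
  ... | inj₂ (inj₁ (y≡v , ty≡u))      = mk⇔ (λ ty≡v → ⊥-elim (u≢v (P.trans (P.sym ty≡u) ty≡v)))
                                            (λ y≡u → ⊥-elim (u≢v (P.trans (P.sym y≡u) y≡v)))
  ... | inj₂ (inj₂ (y≢u , y≢v , ty≡y)) = mk⇔ (λ ty≡v → ⊥-elim (y≢v (P.trans (P.sym ty≡y) ty≡v)))
                                            (λ y≡u → ⊥-elim (y≢u y≡u))

  t-u : t u ≡ v
  t-u = Equivalence.from (t-to-v u) P.refl

  t-v : t v ≡ u
  t-v = Equivalence.from (t-to-u v) P.refl

  below-both : ∀ {w} → w ≢ u → w ≢ v → (toℕ w < toℕ v) ⇔ (toℕ w < toℕ u)
  below-both {w} w≢u w≢v = mk⇔
    (λ w<v → ℕP.≤∧≢⇒< (ℕP.≤-pred (P.subst (toℕ w <_) v≡1+u w<v)) (λ e → w≢u (toℕ-injective e)))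
    (λ w<u → P.subst (toℕ w <_) (P.sym v≡1+u) (ℕP.m<n⇒m<1+n w<u))

  above-both : ∀ {w} → w ≢ u → w ≢ v → (toℕ v < toℕ w) ⇔ (toℕ u < toℕ w)
  above-both {w} w≢u w≢v = mk⇔
    (λ v<w → ℕP.<-trans (ℕP.n<1+n _) (P.subst (_< toℕ w) v≡1+u v<w))
    (λ u<w → P.subst (_< toℕ w) (P.sym v≡1+u)
                     (ℕP.≤∧≢⇒< u<w (λ e → w≢v (toℕ-injective (P.trans (P.sym e) (P.sym v≡1+u))))))

  irreflexive : ∀ {a b} → (a < a) ⇔ (b < b)
  irreflexive {a} {b} = mk⇔ (λ a<a → ⊥-elim (ℕP.n≮n a a<a)) (λ b<b → ⊥-elim (ℕP.n≮n b b<b))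

  transpose-order : ∀ x y → ¬ (x ≡ u × y ≡ v) → ¬ (x ≡ v × y ≡ u)
                  → (toℕ (t y) < toℕ (t x)) ⇔ (toℕ y < toℕ x)
  transpose-order x y not-uv not-vu with transpose-cases x | transpose-cases y
  ... | inj₁ (P.refl , tx) | inj₁ (P.refl , ty) rewrite tx = irreflexive
  ... | inj₁ (P.refl , _)  | inj₂ (inj₁ (P.refl , _)) = ⊥-elim (not-uv (P.refl , P.refl))
  ... | inj₁ (P.refl , tx) | inj₂ (inj₂ (y≢u , y≢v , ty)) rewrite tx | ty = below-both y≢u y≢v
  ... | inj₂ (inj₁ (P.refl , _)) | inj₁ (P.refl , _) = ⊥-elim (not-vu (P.refl , P.refl))
  ... | inj₂ (inj₁ (P.refl , tx)) | inj₂ (inj₁ (P.refl , ty)) rewrite tx = irreflexive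
  ... | inj₂ (inj₁ (P.refl , tx)) | inj₂ (inj₂ (y≢u , y≢v , ty)) rewrite tx | ty = ⇔-sym (below-both y≢u y≢v)
  ... | inj₂ (inj₂ (x≢u , x≢v , tx)) | inj₁ (P.refl , ty) rewrite tx | ty = above-both x≢u x≢v
  ... | inj₂ (inj₂ (x≢u , x≢v , tx)) | inj₂ (inj₁ (P.refl , ty)) rewrite tx | ty = ⇔-sym (above-both x≢u x≢v)
  ... | inj₂ (inj₂ (_ , _ , tx)) | inj₂ (inj₂ (_ , _ , ty)) rewrite tx | ty = mk⇔ id id

module RingSums {c ℓ : Level} (R : CommutativeRing c ℓ) where
  open CommutativeRing R
  open import Relation.Binary.Reasoning.Setoid setoid
  open import Algebra.Properties.Semiring.Sum semiring public
    using (sum; sum-remove; sum-permute; sum-cong-≋; ∑-distrib-+; sum-init-last; sum-replicate; *-distribˡ-sum)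
  open import Algebra.Properties.Semiring.Mult semiring public using (×-congʳ; ×-assocˡ)
    renaming (_×_ to _⨯_)
  open import Algebra.Properties.CommutativeMonoid.Mult +-commutativeMonoid using (×-distrib-+)
  open import Algebra.Properties.CommutativeSemigroup +-commutativeSemigroup public
    using () renaming (interchange to +-interchange)
  open import Algebra.Properties.CommutativeSemigroup *-commutativeSemigroup public
    using () renaming (x∙yz≈y∙xz to *-exchange)

  𝟙 : ∀ {p} {A : Set p} → Dec A → Carrier
  𝟙 (yes _) = 1#
  𝟙 (no _)  = 0#

  𝟙-yes : ∀ {p} {A : Set p} → A → (d : Dec A) → 𝟙 d ≈ 1#
  𝟙-yes a (yes _) = refl
  𝟙-yes a (no ¬a) = ⊥-elim (¬a a)

  𝟙-no : ∀ {p} {A : Set p} → ¬ A → (d : Dec A) → 𝟙 d ≈ 0#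
  𝟙-no ¬a (yes a) = ⊥-elim (¬a a)
  𝟙-no ¬a (no _)  = refl

  𝟙-⇔ : ∀ {p q} {A : Set p} {B : Set q} → (A → B) → (B → A) → (d : Dec A) (e : Dec B) → 𝟙 d ≈ 𝟙 e
  𝟙-⇔ f g (yes a) e = sym (𝟙-yes (f a) e)
  𝟙-⇔ f g (no ¬a) e = sym (𝟙-no (λ b → ¬a (g b)) e)

  𝟙-× : ∀ {p q} {A : Set p} {B : Set q} (d : Dec A) (e : Dec B) → 𝟙 (d ×-dec e) ≈ 𝟙 d * 𝟙 e
  𝟙-× (yes a) (yes b) = sym (*-identityˡ _)
  𝟙-× (yes a) (no b)  = sym (*-identityˡ _)
  𝟙-× (no a)  e       = sym (zeroˡ _)

  𝟙-*-no : ∀ {p} {A : Set p} (d : Dec A) (x : Carrier) → ¬ A → 𝟙 d * x ≈ 0#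
  𝟙-*-no d x ¬a = trans (*-congʳ (𝟙-no ¬a d)) (zeroˡ x)

  𝟙-*-yes : ∀ {p} {A : Set p} (d : Dec A) (x : Carrier) → A → 𝟙 d * x ≈ x
  𝟙-*-yes d x a = trans (*-congʳ (𝟙-yes a d)) (*-identityˡ x)

  𝟙-*-under : ∀ {p} {A : Set p} (d : Dec A) {x y : Carrier} → (A → x ≈ y) → 𝟙 d * x ≈ 𝟙 d * y
  𝟙-*-under (yes a) x≈y = *-congˡ (x≈y a)
  𝟙-*-under (no ¬a) x≈y = trans (zeroˡ _) (sym (zeroˡ _))

  sumR-cong : ∀ {A : Set} {f g : A → Carrier} (xs : List A) → (∀ x → f x ≈ g x) → sumR R f xs ≈ sumR R g xs
  sumR-cong []       f≈g = refl
  sumR-cong (x ∷ xs) f≈g = +-cong (f≈g x) (sumR-cong xs f≈g)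

  sumR-zero : ∀ {A : Set} {f : A → Carrier} (xs : List A) → (∀ x → f x ≈ 0#) → sumR R f xs ≈ 0#
  sumR-zero []       f≈0 = refl
  sumR-zero (x ∷ xs) f≈0 = trans (+-cong (f≈0 x) (sumR-zero xs f≈0)) (+-identityˡ 0#)

  sumR-+ : ∀ {A : Set} (f g : A → Carrier) (xs : List A) → sumR R (λ x → f x + g x) xs ≈ sumR R f xs + sumR R g xs
  sumR-+ f g []       = sym (+-identityˡ 0#)
  sumR-+ f g (x ∷ xs) = trans (+-congˡ (sumR-+ f g xs)) (+-interchange _ _ _ _)

  sumR-*ˡ : ∀ {A : Set} (a : Carrier) (f : A → Carrier) (xs : List A)
          → sumR R (λ x → a * f x) xs ≈ a * sumR R f xs
  sumR-*ˡ a f []       = sym (zeroʳ a)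
  sumR-*ˡ a f (x ∷ xs) = trans (+-congˡ (sumR-*ˡ a f xs)) (sym (distribˡ a _ _))

  sumR-++ : ∀ {A : Set} (f : A → Carrier) (xs ys : List A) → sumR R f (xs ++ ys) ≈ sumR R f xs + sumR R f ys
  sumR-++ f []       ys = sym (+-identityˡ _)
  sumR-++ f (x ∷ xs) ys = trans (+-congˡ (sumR-++ f xs ys)) (sym (+-assoc _ _ _))

  sumR-concatMap : ∀ {A B : Set} (f : B → Carrier) (k : A → List B) (xs : List A)
                 → sumR R f (concatMap k xs) ≈ sumR R (λ x → sumR R f (k x)) xs
  sumR-concatMap f k []       = refl
  sumR-concatMap f k (x ∷ xs) = trans (sumR-++ f (k x) (concatMap k xs)) (+-congˡ (sumR-concatMap f k xs))

  sumR-map : ∀ {A B : Set} (f : B → Carrier) (k : A → B) (xs : List A) → sumR R f (map k xs) ≈ sumR R (f ∘ k) xs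
  sumR-map f k []       = refl
  sumR-map f k (x ∷ xs) = +-congˡ (sumR-map f k xs)

  sumR-filter : ∀ {A : Set} {p} {Q : A → Set p} (Q? : ∀ x → Dec (Q x)) (f : A → Carrier) (xs : List A)
              → sumR R f (filter Q? xs) ≈ sumR R (λ x → 𝟙 (Q? x) * f x) xs
  sumR-filter Q? f [] = refl
  sumR-filter Q? f (x ∷ xs) with Q? x
  ... | yes _ = +-cong (sym (*-identityˡ _)) (sumR-filter Q? f xs)
  ... | no _  = trans (sumR-filter Q? f xs) (trans (sym (+-identityˡ _)) (+-congʳ (sym (zeroˡ _))))

  sumR-comm : ∀ {A B : Set} (g : A → B → Carrier) (xs : List A) (ys : List B)
            → sumR R (λ x → sumR R (g x) ys) xs ≈ sumR R (λ y → sumR R (λ x → g x y) xs) ys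
  sumR-comm g []       ys = sym (sumR-zero ys (λ _ → refl))
  sumR-comm g (x ∷ xs) ys = trans (+-congˡ (sumR-comm g xs ys)) (sym (sumR-+ (g x) _ ys))

  sum-cong : ∀ {n} {f g : Fin n → Carrier} → (∀ x → f x ≈ g x) → sum f ≈ sum g
  sum-cong = sum-cong-≋

  sum-zero : ∀ {n} {f : Fin n → Carrier} → (∀ x → f x ≈ 0#) → sum f ≈ 0#
  sum-zero {zero}  f≈0 = refl
  sum-zero {suc n} f≈0 = trans (+-cong (f≈0 F.zero) (sum-zero (f≈0 ∘ F.suc))) (+-identityˡ 0#)

  sum-*ˡ : ∀ {n} (a : Carrier) (f : Fin n → Carrier) → sum (λ x → a * f x) ≈ a * sum f
  sum-*ˡ a f = sym (*-distribˡ-sum a f)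

  sum-spike : ∀ {n} (p : Fin n) (f : Fin n → Carrier) → (∀ y → y ≢ p → f y ≈ 0#) → sum f ≈ f p
  sum-spike {suc n} p f f≈0 = begin
    sum f                      ≈⟨ sum-remove {i = p} f ⟩
    f p + sum (f ∘ punchIn p)  ≈⟨ +-congˡ (sum-zero (λ z → f≈0 (punchIn p z) (punchInᵢ≢i p z))) ⟩
    f p + 0#                   ≈⟨ +-identityʳ _ ⟩
    f p                        ∎

  sum-differ-at : ∀ {n} (k₀ : Fin n) (f g : Fin n → Carrier) (c : Carrier)
                → f k₀ + c ≈ g k₀ → (∀ k → k ≢ k₀ → f k ≈ g k) → sum f + c ≈ sum g
  sum-differ-at {suc n} k₀ f g c at-k₀ elsewhere = begin
    sum f + c
      ≈⟨ +-congʳ (sum-remove {i = k₀} f) ⟩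
    (f k₀ + sum (f ∘ punchIn k₀)) + c
      ≈⟨ +-congʳ (+-congˡ (sum-cong (λ z → elsewhere _ (punchInᵢ≢i k₀ z)))) ⟩
    (f k₀ + sum (g ∘ punchIn k₀)) + c
      ≈⟨ trans (+-assoc _ _ _) (+-congˡ (+-comm _ _)) ⟩
    f k₀ + (c + sum (g ∘ punchIn k₀))
      ≈⟨ trans (sym (+-assoc _ _ _)) (+-congʳ at-k₀) ⟩
    g k₀ + sum (g ∘ punchIn k₀)
      ≈⟨ sym (sum-remove {i = k₀} g) ⟩
    sum g
      ∎

  sumR-allFin : ∀ {n} (f : Fin n → Carrier) → sumR R f (allFin n) ≈ sum f
  sumR-allFin f = tabulated f id
    where
    tabulated : ∀ {A : Set} {n} (f : A → Carrier) (t : Fin n → A) → sumR R f (tabulate t) ≈ sum (f ∘ t)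
    tabulated {n = zero}  f t = refl
    tabulated {n = suc n} f t = +-congˡ (tabulated f (t ∘ F.suc))

  sumR-sum-comm : ∀ {A : Set} {n} (g : A → Fin n → Carrier) (xs : List A)
                → sumR R (λ x → sum (g x)) xs ≈ sum (λ y → sumR R (λ x → g x y) xs)
  sumR-sum-comm {n = n} g [] = sym (sum-zero {n} (λ _ → refl))
  sumR-sum-comm g (x ∷ xs) = trans (+-congˡ (sumR-sum-comm g xs)) (sym (∑-distrib-+ (g x) _))

  ·ℕ≈× : ∀ k x → _·ℕ_ R k x ≈ k ⨯ x
  ·ℕ≈× zero    x = refl
  ·ℕ≈× (suc k) x = +-congˡ (·ℕ≈× k x)

  ×-zeroʳ : ∀ k → k ⨯ 0# ≈ 0#
  ×-zeroʳ k = trans (sym (sum-replicate k)) (sum-zero {k} (λ _ → refl))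

  ×-distrib-sum : ∀ {n} k (f : Fin n → Carrier) → k ⨯ sum f ≈ sum (λ x → k ⨯ f x)
  ×-distrib-sum {zero}  k f = ×-zeroʳ k
  ×-distrib-sum {suc n} k f = trans (×-distrib-+ (f F.zero) _ k) (+-congˡ (×-distrib-sum k (f ∘ F.suc)))

module FunctionSums {c ℓ : Level} (R : CommutativeRing c ℓ) where
  open CommutativeRing R
  open import Relation.Binary.Reasoning.Setoid setoid
  open RingSums R

  sumFun : ∀ m k → ((Fin m → Fin k) → Carrier) → Carrier
  sumFun m k F = sumR R F (allFuns m k)

  Extensional : ∀ {m k} → ((Fin m → Fin k) → Carrier) → Set _
  Extensional {m} {k} F = ∀ (f g : Fin m → Fin k) → (∀ x → f x ≡ g x) → F f ≈ F g

  sumFun-cong : ∀ m k {F G : (Fin m → Fin k) → Carrier} → (∀ f → F f ≈ G f) → sumFun m k F ≈ sumFun m k G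
  sumFun-cong m k = sumR-cong (allFuns m k)

  sumFun-zero : ∀ m k {F : (Fin m → Fin k) → Carrier} → (∀ f → F f ≈ 0#) → sumFun m k F ≈ 0#
  sumFun-zero m k = sumR-zero (allFuns m k)

  sumFun-empty : ∀ k (F : (Fin 0 → Fin k) → Carrier) (f : Fin 0 → Fin k) → Extensional F → sumFun 0 k F ≈ F f
  sumFun-empty k F f F-ext = trans (+-identityʳ _) (F-ext _ f (λ ()))

  sumFun-cons : ∀ m k (F : (Fin (suc m) → Fin k) → Carrier)
              → sumFun (suc m) k F ≈ sumFun m k (λ f → sum (λ y → F (y ∷ᶠ f)))
  sumFun-cons m k F = begin
    sumR R F (concatMap (λ f → map (λ y → y ∷ᶠ f) (allFin k)) (allFuns m k))
      ≈⟨ sumR-concatMap F _ (allFuns m k) ⟩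
    sumR R (λ f → sumR R F (map (λ y → y ∷ᶠ f) (allFin k))) (allFuns m k)
      ≈⟨ sumFun-cong m k (λ f → trans (sumR-map F _ (allFin k)) (sumR-allFin {k} _)) ⟩
    sumFun m k (λ f → sum (λ y → F (y ∷ᶠ f)))
      ∎

  cons-extensional : ∀ {m k j} {F : (Fin (suc m) → Fin k) → Carrier} (G : Fin j → Fin k) → Extensional F
                   → Extensional (λ f → sum (λ y → F (G y ∷ᶠ f)))
  cons-extensional {j = j} G F-ext f g f≗g =
    sum-cong {j} (λ y → F-ext _ _ (λ { F.zero → P.refl ; (F.suc x) → f≗g x }))

  sumFun-unique : ∀ m k (h : Fin m → Fin k) → sumFun m k (λ f → 𝟙 (all? (λ x → f x ≟ h x))) ≈ 1#
  sumFun-unique zero    k h = trans (sumFun-empty k _ h agree-ext) (𝟙-yes (λ ()) (all? (λ x → h x ≟ h x)))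
    where
    agree-ext : Extensional (λ f → 𝟙 (all? (λ x → f x ≟ h x)))
    agree-ext f g f≗g = 𝟙-⇔ (λ a x → P.trans (P.sym (f≗g x)) (a x)) (λ a x → P.trans (f≗g x) (a x))
                            (all? (λ x → f x ≟ h x)) (all? (λ x → g x ≟ h x))
  sumFun-unique (suc m) k h = begin
    sumFun (suc m) k (λ f → 𝟙 (all? (λ x → f x ≟ h x)))                   ≈⟨ sumFun-cons m k _ ⟩
    sumFun m k (λ f → sum (λ y → 𝟙 (all? (λ x → (y ∷ᶠ f) x ≟ h x))))       ≈⟨ sumFun-cong m k first-value ⟩
    sumFun m k (λ f → 𝟙 (all? (λ x → f x ≟ h (F.suc x))))                  ≈⟨ sumFun-unique m k (h ∘ F.suc) ⟩
    1#                                                                     ∎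
    where
    -- only the first value y = h 0 contributes
    first-value : ∀ f → sum (λ y → 𝟙 (all? (λ x → (y ∷ᶠ f) x ≟ h x))) ≈ 𝟙 (all? (λ x → f x ≟ h (F.suc x)))
    first-value f = trans
      (sum-spike (h F.zero) _ (λ y y≢ → 𝟙-no (λ a → y≢ (a F.zero)) (all? (λ x → (y ∷ᶠ f) x ≟ h x))))
      (𝟙-⇔ (λ a x → a (F.suc x)) (λ { a F.zero → P.refl ; a (F.suc x) → a x })
           (all? (λ x → (h F.zero ∷ᶠ f) x ≟ h x)) (all? (λ x → f x ≟ h (F.suc x))))

  sumFun-relabel : ∀ m {k} (π : Permutation′ k) (F : (Fin m → Fin k) → Carrier) → Extensional F
                 → sumFun m k F ≈ sumFun m k (λ g → F (λ x → π ⟨$⟩ʳ g x))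
  sumFun-relabel zero    π F F-ext = trans (+-identityʳ _) (trans (F-ext _ _ (λ ())) (sym (+-identityʳ _)))
  sumFun-relabel (suc m) {k} π F F-ext = begin
    sumFun (suc m) k F
      ≈⟨ sumFun-cons m k F ⟩
    sumFun m k G
      ≈⟨ sumFun-relabel m π G (cons-extensional id F-ext) ⟩
    sumFun m k (λ g → G (πg g))
      ≈⟨ sumFun-cong m k (λ g → sum-permute _ π) ⟩
    sumFun m k (λ g → sum (λ y → F ((π ⟨$⟩ʳ y) ∷ᶠ πg g)))
      ≈⟨ sumFun-cong m k (λ g → sum-cong (λ y → F-ext _ _ (cons-relabel y g))) ⟩
    sumFun m k (λ g → sum (λ y → F (λ x → π ⟨$⟩ʳ (y ∷ᶠ g) x)))
      ≈⟨ sym (sumFun-cons m k _) ⟩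
    sumFun (suc m) k (λ g → F (λ x → π ⟨$⟩ʳ g x))
      ∎
    where
    G : (Fin m → Fin k) → Carrier
    G f = sum (λ y → F (y ∷ᶠ f))
    πg : (Fin m → Fin k) → Fin m → Fin k
    πg g x = π ⟨$⟩ʳ g x
    cons-relabel : ∀ y g x → ((π ⟨$⟩ʳ y) ∷ᶠ πg g) x ≡ π ⟨$⟩ʳ (y ∷ᶠ g) x
    cons-relabel y g F.zero    = P.refl
    cons-relabel y g (F.suc x) = P.refl

  Avoids? : ∀ {m k} (p : Fin k) (f : Fin m → Fin k) → Dec (∀ x → f x ≢ p)
  Avoids? p f = all? (λ x → ¬? (f x ≟ p))

  sumFun-avoiding : ∀ m {k} (p : Fin (suc k)) (F : (Fin m → Fin (suc k)) → Carrier) → Extensional F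
                  → sumFun m (suc k) (λ f → 𝟙 (Avoids? p f) * F f) ≈ sumFun m k (λ h → F (punchIn p ∘ h))
  sumFun-avoiding zero {k} p F F-ext = trans (+-identityʳ _) (unique-term _)
    where
    unique-term : ∀ f → 𝟙 (Avoids? p f) * F f ≈ sumFun 0 k (λ h → F (punchIn p ∘ h))
    unique-term f = trans (𝟙-*-yes (Avoids? p f) (F f) (λ ()))
      (trans (F-ext f _ (λ ()))
             (sym (sumFun-empty k _ (λ ()) (λ g g′ g≗g′ → F-ext _ _ (λ x → P.cong (punchIn p) (g≗g′ x))))))
  sumFun-avoiding (suc m) {k} p F F-ext = begin
    sumFun (suc m) (suc k) (λ f → 𝟙 (Avoids? p f) * F f)
      ≈⟨ sumFun-cons m (suc k) _ ⟩
    sumFun m (suc k) (λ f → sum (λ y → 𝟙 (Avoids? p (y ∷ᶠ f)) * F (y ∷ᶠ f)))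
      ≈⟨ sumFun-cong m (suc k) first-value ⟩
    sumFun m (suc k) (λ f → 𝟙 (Avoids? p f) * G f)
      ≈⟨ sumFun-avoiding m p G (cons-extensional (punchIn p) F-ext) ⟩
    sumFun m k (λ h → G (punchIn p ∘ h))
      ≈⟨ sumFun-cong m k (λ h → sum-cong {k} (λ z → F-ext _ _ (cons-punchIn z h))) ⟩
    sumFun m k (λ h → sum (λ z → F (punchIn p ∘ (z ∷ᶠ h))))
      ≈⟨ sym (sumFun-cons m k _) ⟩
    sumFun (suc m) k (λ h → F (punchIn p ∘ h))
      ∎
    where
    G : (Fin m → Fin (suc k)) → Carrier
    G f = sum (λ z → F (punchIn p z ∷ᶠ f))
    cons-punchIn : ∀ z h x → (punchIn p z ∷ᶠ (punchIn p ∘ h)) x ≡ punchIn p ((z ∷ᶠ h) x)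
    cons-punchIn z h F.zero    = P.refl
    cons-punchIn z h (F.suc x) = P.refl
    -- the first value must avoid p, i.e. be punchIn p z for some z
    first-value : ∀ f → sum (λ y → 𝟙 (Avoids? p (y ∷ᶠ f)) * F (y ∷ᶠ f)) ≈ 𝟙 (Avoids? p f) * G f
    first-value f = begin
      sum (λ y → 𝟙 (Avoids? p (y ∷ᶠ f)) * F (y ∷ᶠ f))
        ≈⟨ sum-remove {k} {i = p} (λ y → 𝟙 (Avoids? p (y ∷ᶠ f)) * F (y ∷ᶠ f)) ⟩
      𝟙 (Avoids? p (p ∷ᶠ f)) * F (p ∷ᶠ f) + sum (λ z → 𝟙 (Avoids? p (punchIn p z ∷ᶠ f)) * F (punchIn p z ∷ᶠ f))
        ≈⟨ +-cong (𝟙-*-no (Avoids? p (p ∷ᶠ f)) _ (λ a → a F.zero P.refl))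
                  (sum-cong {k} (λ z → *-congʳ (tail-avoids z))) ⟩
      0# + sum (λ z → 𝟙 (Avoids? p f) * F (punchIn p z ∷ᶠ f))
        ≈⟨ trans (+-identityˡ _) (sum-*ˡ {k} _ _) ⟩
      𝟙 (Avoids? p f) * G f
        ∎
      where
      tail-avoids : ∀ z → 𝟙 (Avoids? p (punchIn p z ∷ᶠ f)) ≈ 𝟙 (Avoids? p f)
      tail-avoids z = 𝟙-⇔ (λ a x → a (F.suc x)) (λ { a F.zero → punchInᵢ≢i p z ; a (F.suc x) → a x })
                          (Avoids? p (punchIn p z ∷ᶠ f)) (Avoids? p f)

module InjectionSums {c ℓ : Level} (R : CommutativeRing c ℓ) where
  open CommutativeRing R
  open import Relation.Binary.Reasoning.Setoid setoid
  open RingSums R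
  open FunctionSums R

  Injective : ∀ {m k} → (Fin m → Fin k) → Set
  Injective g = ∀ x y → g x ≡ g y → x ≡ y

  Injective? : ∀ {m k} (g : Fin m → Fin k) → Dec (Injective g)
  Injective? g = all? (λ x → all? (λ y → (g x ≟ g y) →-dec (x ≟ y)))

  sumInj : ∀ m k → ((Fin m → Fin k) → Carrier) → Carrier
  sumInj m k Ψ = sumFun m k (λ g → 𝟙 (Injective? g) * Ψ g)

  𝟙-Injective-cong : ∀ {m k} (f g : Fin m → Fin k) → (∀ x → f x ≡ g x)
                   → 𝟙 (Injective? f) ≈ 𝟙 (Injective? g)
  𝟙-Injective-cong f g f≗g =
    𝟙-⇔ (λ inj x y e → inj x y (P.trans (f≗g x) (P.trans e (P.sym (f≗g y)))))
        (λ inj x y e → inj x y (P.trans (P.sym (f≗g x)) (P.trans e (f≗g y)))) (Injective? f) (Injective? g)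

  𝟙-Injective-cons : ∀ {m k} (p : Fin k) (f : Fin m → Fin k)
                   → 𝟙 (Injective? (p ∷ᶠ f)) ≈ 𝟙 (Avoids? p f) * 𝟙 (Injective? f)
  𝟙-Injective-cons p f = trans (𝟙-⇔ split join (Injective? (p ∷ᶠ f)) (Avoids? p f ×-dec Injective? f))
                               (𝟙-× (Avoids? p f) (Injective? f))
    where
    split : Injective (p ∷ᶠ f) → (∀ x → f x ≢ p) × Injective f
    split inj = (λ x e → zero≢suc (inj F.zero (F.suc x) (P.sym e)))
              , (λ x y e → suc-injective (inj (F.suc x) (F.suc y) e))
      where
      zero≢suc : ∀ {m} {x : Fin m} → F.zero ≢ F.suc x
      zero≢suc ()
    join : (∀ x → f x ≢ p) × Injective f → Injective (p ∷ᶠ f)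
    join (avoids , inj) F.zero    F.zero    e = P.refl
    join (avoids , inj) F.zero    (F.suc y) e = ⊥-elim (avoids y (P.sym e))
    join (avoids , inj) (F.suc x) F.zero    e = ⊥-elim (avoids x e)
    join (avoids , inj) (F.suc x) (F.suc y) e = P.cong F.suc (inj x y e)

  𝟙-Injective-punchIn : ∀ {m k} (p : Fin (suc k)) (h : Fin m → Fin k)
                      → 𝟙 (Injective? (punchIn p ∘ h)) ≈ 𝟙 (Injective? h)
  𝟙-Injective-punchIn p h = 𝟙-⇔ (λ inj x y e → inj x y (P.cong (punchIn p) e))
                                (λ inj x y e → inj x y (punchIn-injective p _ _ e)) (Injective? (punchIn p ∘ h)) (Injective? h)

  sumInj-cons : ∀ m k (Ψ : (Fin (suc m) → Fin (suc k)) → Carrier) → Extensional Ψ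
              → sumInj (suc m) (suc k) Ψ ≈ sum {suc k} (λ p → sumInj m k (λ h → Ψ (p ∷ᶠ (punchIn p ∘ h))))
  sumInj-cons m k Ψ Ψ-ext = begin
    sumInj (suc m) (suc k) Ψ
      ≈⟨ sumFun-cons m (suc k) _ ⟩
    sumFun m (suc k) (λ f → sum {suc k} (λ p → 𝟙 (Injective? (p ∷ᶠ f)) * Ψ (p ∷ᶠ f)))
      ≈⟨ sumR-sum-comm {n = suc k} (λ f p → 𝟙 (Injective? (p ∷ᶠ f)) * Ψ (p ∷ᶠ f)) (allFuns m (suc k)) ⟩
    sum {suc k} (λ p → sumFun m (suc k) (λ f → 𝟙 (Injective? (p ∷ᶠ f)) * Ψ (p ∷ᶠ f)))
      ≈⟨ sum-cong {suc k} first-value ⟩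
    sum {suc k} (λ p → sumInj m k (λ h → Ψ (p ∷ᶠ (punchIn p ∘ h))))
      ∎
    where
    first-value : ∀ p → sumFun m (suc k) (λ f → 𝟙 (Injective? (p ∷ᶠ f)) * Ψ (p ∷ᶠ f))
                      ≈ sumInj m k (λ h → Ψ (p ∷ᶠ (punchIn p ∘ h)))
    first-value p = begin
      sumFun m (suc k) (λ f → 𝟙 (Injective? (p ∷ᶠ f)) * Ψ (p ∷ᶠ f))
        ≈⟨ sumFun-cong m (suc k) (λ f → trans (*-congʳ (𝟙-Injective-cons p f)) (*-assoc _ _ _)) ⟩
      sumFun m (suc k) (λ f → 𝟙 (Avoids? p f) * (𝟙 (Injective? f) * Ψ (p ∷ᶠ f)))
        ≈⟨ sumFun-avoiding m p (λ f → 𝟙 (Injective? f) * Ψ (p ∷ᶠ f)) tail-extensional ⟩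
      sumFun m k (λ h → 𝟙 (Injective? (punchIn p ∘ h)) * Ψ (p ∷ᶠ (punchIn p ∘ h)))
        ≈⟨ sumFun-cong m k (λ h → *-congʳ (𝟙-Injective-punchIn p h)) ⟩
      sumInj m k (λ h → Ψ (p ∷ᶠ (punchIn p ∘ h)))
        ∎
      where
      tail-extensional : Extensional (λ f → 𝟙 (Injective? f) * Ψ (p ∷ᶠ f))
      tail-extensional f g f≗g =
        *-cong (𝟙-Injective-cong f g f≗g) (Ψ-ext _ _ (λ { F.zero → P.refl ; (F.suc x) → f≗g x }))

  sumInj-cong : ∀ m k {Ψ Φ : (Fin m → Fin k) → Carrier} → (∀ g → Ψ g ≈ Φ g)
              → sumInj m k Ψ ≈ sumInj m k Φ
  sumInj-cong m k Ψ≈Φ = sumFun-cong m k (λ g → *-congˡ (Ψ≈Φ g))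

  sumInj-zero : ∀ m k {Ψ : (Fin m → Fin k) → Carrier} → (∀ g → Ψ g ≈ 0#) → sumInj m k Ψ ≈ 0#
  sumInj-zero m k Ψ≈0 = sumFun-zero m k (λ g → trans (*-congˡ (Ψ≈0 g)) (zeroʳ _))

  sumInj-+ : ∀ m k (Ψ Φ : (Fin m → Fin k) → Carrier)
           → sumInj m k Ψ + sumInj m k Φ ≈ sumInj m k (λ g → Ψ g + Φ g)
  sumInj-+ m k Ψ Φ = trans (sym (sumR-+ _ _ (allFuns m k))) (sumFun-cong m k (λ g → sym (distribˡ _ _ _)))

  sumInj-cong-injective : ∀ m k {Ψ Φ : (Fin m → Fin k) → Carrier} → (∀ g → Injective g → Ψ g ≈ Φ g)
                        → sumInj m k Ψ ≈ sumInj m k Φ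
  sumInj-cong-injective m k Ψ≈Φ = sumFun-cong m k (λ g → 𝟙-*-under (Injective? g) (Ψ≈Φ g))

  sumInj-sum : ∀ m k {n} (Ψ : Fin n → (Fin m → Fin k) → Carrier)
             → sumInj m k (λ g → sum (λ q → Ψ q g)) ≈ sum (λ q → sumInj m k (Ψ q))
  sumInj-sum m k {n} Ψ = trans (sumFun-cong m k (λ g → sym (sum-*ˡ {n} _ _)))
                               (sumR-sum-comm {n = n} (λ g q → 𝟙 (Injective? g) * Ψ q g) (allFuns m k))

  sumInj-relabel : ∀ m {k} (π : Permutation′ k) (Ψ : (Fin m → Fin k) → Carrier) → Extensional Ψ
                 → sumInj m k Ψ ≈ sumInj m k (λ g → Ψ (λ x → π ⟨$⟩ʳ g x))
  sumInj-relabel m {k} π Ψ Ψ-ext = trans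
    (sumFun-relabel m π (λ g → 𝟙 (Injective? g) * Ψ g) (λ f g f≗g → *-cong (𝟙-Injective-cong f g f≗g) (Ψ-ext f g f≗g)))
    (sumFun-cong m k (λ g → *-congʳ (𝟙-⇔ (λ inj x y e → inj x y (P.cong (π ⟨$⟩ʳ_) e)) (λ inj x y e → inj x y (π-injective e))
                                          (Injective? (λ x → π ⟨$⟩ʳ g x)) (Injective? g))))
    where
    π-injective : ∀ {u v} → π ⟨$⟩ʳ u ≡ π ⟨$⟩ʳ v → u ≡ v
    π-injective {u} {v} e = P.trans (P.sym (inverseˡ π)) (P.trans (P.cong (π ⟨$⟩ˡ_) e) (inverseˡ π))

  Pin : ∀ {m k} (b : Fin m) (p : Fin k) → (Fin m → Fin k) → Carrier
  Pin b p g = 𝟙 (g b ≟ p)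

  Pin-cong : ∀ {m k} (b : Fin m) (p : Fin k) (f g : Fin m → Fin k) → (∀ x → f x ≡ g x)
           → Pin b p f ≈ Pin b p g
  Pin-cong b p f g f≗g = 𝟙-⇔ (P.trans (P.sym (f≗g b))) (P.trans (f≗g b)) (f b ≟ p) (g b ≟ p)

  𝟙-punchIn≟ : ∀ {k} {r p : Fin (suc k)} (r≢p : r ≢ p) (y : Fin k)
             → 𝟙 (punchIn r y ≟ p) ≈ 𝟙 (y ≟ punchOut r≢p)
  𝟙-punchIn≟ {r = r} {p} r≢p y =
    𝟙-⇔ (λ e → punchIn-injective r y _ (P.trans e (P.sym (punchIn-punchOut r≢p))))
        (λ e → P.trans (P.cong (punchIn r) e) (punchIn-punchOut r≢p)) (punchIn r y ≟ p) (y ≟ punchOut r≢p)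

  sum-except : ∀ {m} (p : Fin (suc m)) (T : Fin (suc m) → Carrier) (c : Carrier)
             → T p ≈ 0# → (∀ z → T (punchIn p z) ≈ c) → sum T ≈ m ⨯ c
  sum-except {m} p T c Tp≈0 T≈c = begin
    sum T                          ≈⟨ sum-remove {m} {i = p} T ⟩
    T p + sum {m} (T ∘ punchIn p)  ≈⟨ +-cong Tp≈0 (sum-cong {m} T≈c) ⟩
    0# + sum {m} (λ _ → c)         ≈⟨ trans (+-identityˡ _) (sum-replicate m) ⟩
    m ⨯ c                          ∎

  sumInj-pin-first : ∀ m (p : Fin (suc m)) (Ψ : (Fin (suc m) → Fin (suc m)) → Carrier) → Extensional Ψ
                   → sumInj (suc m) (suc m) (λ g → Pin F.zero p g * Ψ g) ≈ sumInj m m (λ h → Ψ (p ∷ᶠ (punchIn p ∘ h)))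
  sumInj-pin-first m p Ψ Ψ-ext = begin
    sumInj (suc m) (suc m) (λ g → Pin F.zero p g * Ψ g)
      ≈⟨ sumInj-cons m m _ (λ f g f≗g → *-cong (Pin-cong F.zero p f g f≗g) (Ψ-ext f g f≗g)) ⟩
    sum {suc m} (λ r → sumInj m m (λ h → 𝟙 (r ≟ p) * Ψ (r ∷ᶠ (punchIn r ∘ h))))
      ≈⟨ sum-spike {suc m} p (λ r → sumInj m m (λ h → 𝟙 (r ≟ p) * Ψ (r ∷ᶠ (punchIn r ∘ h))))
                   (λ r r≢p → sumInj-zero m m (λ h → 𝟙-*-no (r ≟ p) _ r≢p)) ⟩
    sumInj m m (λ h → 𝟙 (p ≟ p) * Ψ (p ∷ᶠ (punchIn p ∘ h)))
      ≈⟨ sumInj-cong m m (λ h → 𝟙-*-yes (p ≟ p) _ P.refl) ⟩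
    sumInj m m (λ h → Ψ (p ∷ᶠ (punchIn p ∘ h)))
      ∎

  count-injections : ∀ n (a : Carrier) → sumInj n n (λ _ → a) ≈ (n !) ⨯ a
  count-injections zero    a = trans (+-identityʳ _) (empty-function (λ ()))
    where
    empty-function : ∀ (f : Fin 0 → Fin 0) → 𝟙 (Injective? f) * a ≈ a + 0#
    empty-function f = trans (𝟙-*-yes (Injective? f) a (λ ())) (sym (+-identityʳ a))
  count-injections (suc m) a = begin
    sumInj (suc m) (suc m) (λ _ → a)          ≈⟨ sumInj-cons m m _ (λ _ _ _ → refl) ⟩
    sum {suc m} (λ p → sumInj m m (λ _ → a))  ≈⟨ sum-cong {suc m} (λ p → count-injections m a) ⟩
    sum {suc m} (λ p → (m !) ⨯ a)             ≈⟨ sum-replicate (suc m) ⟩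
    suc m ⨯ ((m !) ⨯ a)                       ≈⟨ ×-assocˡ a (suc m) (m !) ⟩
    (suc m !) ⨯ a                             ∎

  count-injections-pin₁ : ∀ n (a : Carrier) (b p : Fin n) → sumInj n n (λ g → Pin b p g * a) ≈ ((n ∸ 1) !) ⨯ a
  count-injections-pin₁ (suc m) a F.zero p =
    trans (sumInj-pin-first m p (λ _ → a) (λ _ _ _ → refl)) (count-injections m a)
  count-injections-pin₁ (suc (suc m)) a (F.suc b) p = begin
    sumInj (suc (suc m)) (suc (suc m)) (λ g → Pin (F.suc b) p g * a)
      ≈⟨ sumInj-cons (suc m) (suc m) _ (λ f g f≗g → *-congʳ (Pin-cong (F.suc b) p f g f≗g)) ⟩
    sum {suc (suc m)} T
      ≈⟨ sum-except p T _ (sumInj-zero (suc m) (suc m) (λ h → 𝟙-*-no (punchIn p (h b) ≟ p) a (punchInᵢ≢i p (h b)))) T-rest ⟩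
    suc m ⨯ ((m !) ⨯ a)
      ≈⟨ ×-assocˡ a (suc m) (m !) ⟩
    (suc m !) ⨯ a
      ∎
    where
    T : Fin (suc (suc m)) → Carrier
    T r = sumInj (suc m) (suc m) (λ h → 𝟙 (punchIn r (h b) ≟ p) * a)
    T-rest : ∀ z → T (punchIn p z) ≈ (m !) ⨯ a
    T-rest z = trans (sumInj-cong (suc m) (suc m) (λ h → *-congʳ (𝟙-punchIn≟ (punchInᵢ≢i p z) (h b))))
                     (count-injections-pin₁ (suc m) a b (punchOut (punchInᵢ≢i p z)))

  count-injections-pin-first : ∀ m (a : Carrier) (b₂ : Fin m) (p₁ p₂ : Fin (suc m)) → p₁ ≢ p₂
    → sumInj (suc m) (suc m) (λ g → Pin F.zero p₁ g * (Pin (F.suc b₂) p₂ g * a)) ≈ ((m ∸ 1) !) ⨯ a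
  count-injections-pin-first m a b₂ p₁ p₂ p₁≢p₂ = begin
    sumInj (suc m) (suc m) (λ g → Pin F.zero p₁ g * (Pin (F.suc b₂) p₂ g * a))
      ≈⟨ sumInj-pin-first m p₁ (λ g → Pin (F.suc b₂) p₂ g * a) (λ f g f≗g → *-congʳ (Pin-cong (F.suc b₂) p₂ f g f≗g)) ⟩
    sumInj m m (λ h → 𝟙 (punchIn p₁ (h b₂) ≟ p₂) * a)
      ≈⟨ sumInj-cong m m (λ h → *-congʳ (𝟙-punchIn≟ p₁≢p₂ (h b₂))) ⟩
    sumInj m m (λ h → Pin b₂ (punchOut p₁≢p₂) h * a)
      ≈⟨ count-injections-pin₁ m a b₂ (punchOut p₁≢p₂) ⟩
    ((m ∸ 1) !) ⨯ a
      ∎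

  count-injections-pin₂ : ∀ n (a : Carrier) (b₁ b₂ p₁ p₂ : Fin n) → b₁ ≢ b₂ → p₁ ≢ p₂
                        → sumInj n n (λ g → Pin b₁ p₁ g * (Pin b₂ p₂ g * a)) ≈ ((n ∸ 2) !) ⨯ a
  count-injections-pin₂ (suc m) a F.zero F.zero p₁ p₂ b₁≢b₂ p₁≢p₂ = ⊥-elim (b₁≢b₂ P.refl)
  count-injections-pin₂ (suc m) a F.zero (F.suc b₂) p₁ p₂ b₁≢b₂ p₁≢p₂ = count-injections-pin-first m a b₂ p₁ p₂ p₁≢p₂
  count-injections-pin₂ (suc m) a (F.suc b₁) F.zero p₁ p₂ b₁≢b₂ p₁≢p₂ =
    trans (sumInj-cong (suc m) (suc m) (λ g → *-exchange _ _ _))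
          (count-injections-pin-first m a b₁ p₂ p₁ (λ e → p₁≢p₂ (P.sym e)))
  count-injections-pin₂ 2 a (F.suc F.zero) (F.suc F.zero) p₁ p₂ b₁≢b₂ p₁≢p₂ = ⊥-elim (b₁≢b₂ P.refl)
  count-injections-pin₂ (suc (suc (suc m))) a (F.suc b₁) (F.suc b₂) p₁ p₂ b₁≢b₂ p₁≢p₂ = begin
    sumInj (suc n) (suc n) (λ g → Pin (F.suc b₁) p₁ g * (Pin (F.suc b₂) p₂ g * a))
      ≈⟨ sumInj-cons n n _ (λ f g f≗g → *-cong (Pin-cong _ p₁ f g f≗g) (*-congʳ (Pin-cong _ p₂ f g f≗g))) ⟩
    sum {suc n} T
      ≈⟨ sum-remove {n} {i = p₁} T ⟩
    T p₁ + sum {n} (T ∘ punchIn p₁)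
      ≈⟨ +-cong T-p₁ (sum-except z₂ (T ∘ punchIn p₁) _ T-p₂ T-rest) ⟩
    0# + suc m ⨯ ((m !) ⨯ a)
      ≈⟨ trans (+-identityˡ _) (×-assocˡ a (suc m) (m !)) ⟩
    (suc m !) ⨯ a
      ∎
    where
    n = suc (suc m)
    T : Fin (suc n) → Carrier
    T r = sumInj n n (λ h → 𝟙 (punchIn r (h b₁) ≟ p₁) * (𝟙 (punchIn r (h b₂) ≟ p₂) * a))
    -- the first value can be neither p₁ nor p₂ = punchIn p₁ z₂ ...
    z₂ : Fin n
    z₂ = punchOut p₁≢p₂
    T-p₁ : T p₁ ≈ 0#
    T-p₁ = sumInj-zero n n (λ h → 𝟙-*-no (punchIn p₁ (h b₁) ≟ p₁) _ (punchInᵢ≢i p₁ (h b₁)))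
    T-p₂ : T (punchIn p₁ z₂) ≈ 0#
    T-p₂ = sumInj-zero n n (λ h → trans (*-congˡ (𝟙-*-no (punchIn r (h b₂) ≟ p₂) a (never-p₂ h))) (zeroʳ _))
      where
      r = punchIn p₁ z₂
      never-p₂ : ∀ h → punchIn r (h b₂) ≢ p₂
      never-p₂ h e = punchInᵢ≢i r (h b₂) (P.trans e (P.sym (punchIn-punchOut p₁≢p₂)))
    -- ... and every other first value r leaves an injection of n values with two pins.
    T-rest : ∀ w → T (punchIn p₁ (punchIn z₂ w)) ≈ (m !) ⨯ a
    T-rest w = begin
      T r
        ≈⟨ sumInj-cong n n (λ h → *-cong (𝟙-punchIn≟ r≢p₁ (h b₁)) (*-congʳ (𝟙-punchIn≟ r≢p₂ (h b₂)))) ⟩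
      sumInj n n (λ h → Pin b₁ (punchOut r≢p₁) h * (Pin b₂ (punchOut r≢p₂) h * a))
        ≈⟨ count-injections-pin₂ n a b₁ b₂ _ _ (λ e → b₁≢b₂ (P.cong F.suc e)) (λ e → p₁≢p₂ (punchOut-injective r≢p₁ r≢p₂ e)) ⟩
      (m !) ⨯ a
        ∎
      where
      r = punchIn p₁ (punchIn z₂ w)
      r≢p₁ : r ≢ p₁
      r≢p₁ = punchInᵢ≢i p₁ (punchIn z₂ w)
      r≢p₂ : r ≢ p₂
      r≢p₂ e = punchInᵢ≢i z₂ w (punchIn-injective p₁ _ _ (P.trans e (P.sym (punchIn-punchOut p₁≢p₂))))

module PermutationSums {c ℓ : Level} (R : CommutativeRing c ℓ) where
  open CommutativeRing R
  open import Relation.Binary.Reasoning.Setoid setoid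
  open RingSums R
  open FunctionSums R
  open InjectionSums R

  -- An injection Fin n → Fin n is onto (pigeonhole).
  injective⇒surjective : ∀ {n} (g : Fin n → Fin n) → Injective g → ∀ y → ∃ λ x → g x ≡ y
  injective⇒surjective {suc n} g inj y with any? (λ x → g x ≟ y)
  ... | yes hit = hit
  ... | no miss = ⊥-elim (ℕP.1+n≰n (injective⇒≤ {f = g-without-y} g-without-y-injective))
    where
    g-without-y : Fin (suc n) → Fin n
    g-without-y x = punchOut {i = y} {j = g x} (λ e → miss (x , P.sym e))
    g-without-y-injective : ∀ {x x′} → g-without-y x ≡ g-without-y x′ → x ≡ x′
    g-without-y-injective {x} {x′} e =
      inj x x′ (punchOut-injective {i = y} (λ e → miss (x , P.sym e)) (λ e → miss (x′ , P.sym e)) e)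

  Inverses? : ∀ {n} (f g : Fin n → Fin n) → Dec ((∀ y → f (g y) ≡ y) × (∀ x → g (f x) ≡ x))
  Inverses? f g = all? (λ y → f (g y) ≟ y) ×-dec all? (λ x → g (f x) ≟ x)

  count-inverses : ∀ n (g : Fin n → Fin n) → sumFun n n (λ f → 𝟙 (Inverses? f g)) ≈ 𝟙 (Injective? g)
  count-inverses n g with Injective? g
  ... | no ¬inj =
    sumFun-zero n n (λ f → 𝟙-no (λ fg,gf → ¬inj (left-inverse⇒injective f (proj₁ fg,gf))) (Inverses? f g))
    where
    left-inverse⇒injective : ∀ f → (∀ y → f (g y) ≡ y) → Injective g
    left-inverse⇒injective f fg x y e = P.trans (P.sym (fg x)) (P.trans (P.cong f e) (fg y))
  ... | yes inj = trans (sumFun-cong n n (λ f → 𝟙-⇔ (to f) (from f) (Inverses? f g) (all? (λ x → f x ≟ g⁻¹ x))))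
                        (sumFun-unique n n g⁻¹)
    where
    g⁻¹ : Fin n → Fin n
    g⁻¹ y = proj₁ (injective⇒surjective g inj y)
    g∘g⁻¹ : ∀ y → g (g⁻¹ y) ≡ y
    g∘g⁻¹ y = proj₂ (injective⇒surjective g inj y)
    to : ∀ f → (∀ y → f (g y) ≡ y) × (∀ x → g (f x) ≡ x) → ∀ x → f x ≡ g⁻¹ x
    to f (_ , gf) x = inj _ _ (P.trans (gf x) (P.sym (g∘g⁻¹ x)))
    from : ∀ f → (∀ x → f x ≡ g⁻¹ x) → (∀ y → f (g y) ≡ y) × (∀ x → g (f x) ≡ x)
    from f f≗g⁻¹ = (λ y → P.trans (f≗g⁻¹ (g y)) (inj _ _ (g∘g⁻¹ (g y))))
                 , (λ x → P.trans (P.cong g (f≗g⁻¹ x)) (g∘g⁻¹ x))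

  -- allPerms n is concatMap pick (Pairs n) for a function `pick` local to Defs;
  -- allPerms-pick exposes that function (found by unification) for reasoning.
  Pairs : ∀ n → List ((Fin n → Fin n) × (Fin n → Fin n))
  Pairs n = concatMap (λ f → map (λ g → f , g) (allFuns n n)) (allFuns n n)

  allPerms-pick : ∀ n → Σ (((Fin n → Fin n) × (Fin n → Fin n)) → List (Permutation′ n))
                          λ pick → allPerms n ≡ concatMap pick (Pairs n)
  allPerms-pick n = _ , P.refl

  sum-pick : ∀ n (H : (Fin n → Fin n) → Carrier) (f g : Fin n → Fin n)
           → sumR R (λ σ → H (σ ⟨$⟩ˡ_)) (proj₁ (allPerms-pick n) (f , g)) ≈ 𝟙 (Inverses? f g) * H g
  sum-pick n H f g with all? (λ y → f (g y) ≟ y) | all? (λ x → g (f x) ≟ x)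
  ... | yes _ | yes _ = trans (+-identityʳ _) (sym (*-identityˡ _))
  ... | yes _ | no _  = sym (zeroˡ _)
  ... | no _  | yes _ = sym (zeroˡ _)
  ... | no _  | no _  = sym (zeroˡ _)

  sum-allPerms : ∀ n (H : (Fin n → Fin n) → Carrier)
               → sumR R (λ σ → H (σ ⟨$⟩ˡ_)) (allPerms n) ≈ sumInj n n H
  sum-allPerms n H = begin
    sumR R Hσ (allPerms n)
      ≡⟨ P.cong (sumR R Hσ) (proj₂ (allPerms-pick n)) ⟩
    sumR R Hσ (concatMap pick (Pairs n))
      ≈⟨ sumR-concatMap Hσ pick (Pairs n) ⟩
    sumR R (λ fg → sumR R Hσ (pick fg)) (Pairs n)
      ≈⟨ sumR-concatMap _ (λ f → map (λ g → f , g) (allFuns n n)) (allFuns n n) ⟩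
    sumFun n n (λ f → sumR R (λ fg → sumR R Hσ (pick fg)) (map (λ g → f , g) (allFuns n n)))
      ≈⟨ sumFun-cong n n (λ f → trans (sumR-map _ (λ g → f , g) (allFuns n n)) (sumFun-cong n n (sum-pick n H f))) ⟩
    sumFun n n (λ f → sumFun n n (λ g → 𝟙 (Inverses? f g) * H g))
      ≈⟨ sumR-comm (λ f g → 𝟙 (Inverses? f g) * H g) (allFuns n n) (allFuns n n) ⟩
    sumFun n n (λ g → sumFun n n (λ f → 𝟙 (Inverses? f g) * H g))
      ≈⟨ sumFun-cong n n count ⟩
    sumInj n n H
      ∎
    where
    Hσ : Permutation′ n → Carrier
    Hσ σ = H (σ ⟨$⟩ˡ_)
    pick = proj₁ (allPerms-pick n)
    count : ∀ g → sumFun n n (λ f → 𝟙 (Inverses? f g) * H g) ≈ 𝟙 (Injective? g) * H g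
    count g = begin
      sumFun n n (λ f → 𝟙 (Inverses? f g) * H g)  ≈⟨ sumFun-cong n n (λ f → *-comm _ _) ⟩
      sumFun n n (λ f → H g * 𝟙 (Inverses? f g))  ≈⟨ sumR-*ˡ (H g) _ (allFuns n n) ⟩
      H g * sumFun n n (λ f → 𝟙 (Inverses? f g))  ≈⟨ *-congˡ (count-inverses n g) ⟩
      H g * 𝟙 (Injective? g)                      ≈⟨ *-comm _ _ ⟩
      𝟙 (Injective? g) * H g                      ∎

  Weight : ∀ {n} (X : ℕ → Carrier) (a b : Fin n) (τ : Fin n → Fin n) → Carrier
  Weight X a b τ = 𝟙 (toℕ (τ b) ℕ.≟ suc (toℕ (τ a))) * (X (suc (toℕ (τ a))) * desX R X τ)

  sumSab-as-sumInj : ∀ n X (a b : Fin n) → sumSab R n X a b ≈ sumInj n n (Weight X a b)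
  sumSab-as-sumInj n X a b =
    trans (sumR-filter (inSab? a b) _ (allPerms n)) (sum-allPerms n (Weight X a b))

module Descents {c ℓ : Level} (R : CommutativeRing c ℓ) where
  open CommutativeRing R
  open import Relation.Binary.Reasoning.Setoid setoid
  open RingSums R
  open FunctionSums R
  open InjectionSums R

  descent : ∀ {m} (X : ℕ → Carrier) (τ : Fin (suc m) → Fin (suc m)) → Fin m → Carrier
  descent X τ k = 𝟙 (toℕ (τ (F.suc k)) ℕ.<? toℕ (τ (inject₁ k))) * X (suc (toℕ k))

  -- desX is a list sum of a term local to Defs; desX-term exposes it (by unification).
  desX-term : ∀ {m} X (τ : Fin (suc m) → Fin (suc m))
            → Σ (Fin m → Carrier) λ term → desX R X τ ≡ sumR R term (allFin m)
  desX-term X τ = _ , P.refl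

  desX-as-sum : ∀ m X (τ : Fin (suc m) → Fin (suc m)) → desX R X τ ≈ sum {m} (descent X τ)
  desX-as-sum m X τ = trans (sumR-cong (allFin m) same-term) (sumR-allFin {m} (descent X τ))
    where
    same-term : ∀ k → proj₁ (desX-term X τ) k ≈ descent X τ k
    same-term k with toℕ (τ (F.suc k)) ℕ.<? toℕ (τ (inject₁ k))
    ... | yes _ = sym (*-identityˡ _)
    ... | no _  = sym (zeroˡ _)

  desX-extensional : ∀ m X → Extensional {suc m} {suc m} (desX R X)
  desX-extensional m X f g f≗g = begin
    desX R X f
      ≈⟨ desX-as-sum m X f ⟩
    sum {m} (descent X f)
      ≈⟨ sum-cong {m} (λ k → *-congʳ (𝟙-⇔ (same-order k) (same-order′ k) (_ ℕ.<? _) (_ ℕ.<? _))) ⟩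
    sum {m} (descent X g)
      ≈⟨ sym (desX-as-sum m X g) ⟩
    desX R X g
      ∎
    where
    same-order : ∀ k → toℕ (f (F.suc k)) < toℕ (f (inject₁ k)) → toℕ (g (F.suc k)) < toℕ (g (inject₁ k))
    same-order k = P.subst₂ _<_ (P.cong toℕ (f≗g (F.suc k))) (P.cong toℕ (f≗g (inject₁ k)))
    same-order′ : ∀ k → toℕ (g (F.suc k)) < toℕ (g (inject₁ k)) → toℕ (f (F.suc k)) < toℕ (f (inject₁ k))
    same-order′ k = P.subst₂ _<_ (P.cong toℕ (P.sym (f≗g (F.suc k)))) (P.cong toℕ (P.sym (f≗g (inject₁ k))))

  consecutive : ∀ {m} (k : Fin m) {a b : Fin (suc m)} → inject₁ k ≡ a → F.suc k ≡ b → toℕ b ≡ suc (toℕ a)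
  consecutive k P.refl P.refl = P.cong suc (P.sym (toℕ-inject₁ k))

  -- Swapping the adjacent values q, q⁺ = q+1 of an injection τ with τ(j) = q and
  -- τ(i) = q⁺ only affects the descent at a position carrying the pair {q, q⁺}.
  module SwapValues {m : ℕ} (X : ℕ → Carrier) (q q⁺ : Fin (suc m)) (q⁺≡1+q : toℕ q⁺ ≡ suc (toℕ q))
                    (τ : Fin (suc m) → Fin (suc m)) (τ-injective : Injective τ)
                    (i j : Fin (suc m)) (τj≡q : τ j ≡ q) (τi≡q⁺ : τ i ≡ q⁺) where
    open AdjacentValues q q⁺ q⁺≡1+q using (t; t-u; t-v; transpose-order)

    at-j : ∀ {x} → τ x ≡ q → x ≡ j
    at-j τx≡q = τ-injective _ _ (P.trans τx≡q (P.sym τj≡q))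

    at-i : ∀ {x} → τ x ≡ q⁺ → x ≡ i
    at-i τx≡q⁺ = τ-injective _ _ (P.trans τx≡q⁺ (P.sym τi≡q⁺))

    descent-unchanged : ∀ k → ¬ (τ (inject₁ k) ≡ q × τ (F.suc k) ≡ q⁺) → ¬ (τ (inject₁ k) ≡ q⁺ × τ (F.suc k) ≡ q)
                      → descent X (t ∘ τ) k ≈ descent X τ k
    descent-unchanged k not-ascent not-descent =
      *-congʳ (𝟙-⇔ (Equivalence.to order) (Equivalence.from order) (_ ℕ.<? _) (_ ℕ.<? _))
      where
      order = transpose-order (τ (inject₁ k)) (τ (F.suc k)) not-ascent not-descent

    -- (q, q⁺) would sit at (j, j+1) = (j, i), impossible if i < j.
    no-ascent-pair : toℕ i < toℕ j → ∀ k → ¬ (τ (inject₁ k) ≡ q × τ (F.suc k) ≡ q⁺)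
    no-ascent-pair i<j k (τk≡q , τk+1≡q⁺) =
      ℕP.<-asym i<j (P.subst (toℕ j <_) (P.sym i≡1+j) (ℕP.n<1+n (toℕ j)))
      where
      i≡1+j = consecutive k (at-j τk≡q) (at-i τk+1≡q⁺)

    descent-pair : ∀ k → τ (inject₁ k) ≡ q⁺ → τ (F.suc k) ≡ q → toℕ j ≡ suc (toℕ i)
    descent-pair k τk≡q⁺ τk+1≡q = consecutive k (at-i τk≡q⁺) (at-j τk+1≡q)

    -- If j > i+1 no position carries the pair, so des_X is unchanged.
    desX-swap-far : suc (toℕ i) < toℕ j → desX R X (t ∘ τ) ≈ desX R X τ
    desX-swap-far 1+i<j = begin
      desX R X (t ∘ τ)
        ≈⟨ desX-as-sum m X (t ∘ τ) ⟩
      sum {m} (descent X (t ∘ τ))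
        ≈⟨ sum-cong {m} (λ k → descent-unchanged k (no-ascent-pair i<j k) (not-descent k)) ⟩
      sum {m} (descent X τ)
        ≈⟨ sym (desX-as-sum m X τ) ⟩
      desX R X τ
        ∎
      where
      i<j = ℕP.<-trans (ℕP.n<1+n (toℕ i)) 1+i<j
      not-descent : ∀ k → ¬ (τ (inject₁ k) ≡ q⁺ × τ (F.suc k) ≡ q)
      not-descent k (τk≡q⁺ , τk+1≡q) = ℕP.<-irrefl (P.sym (descent-pair k τk≡q⁺ τk+1≡q)) 1+i<j

    -- If j = i+1, τ has a descent at position i and t ∘ τ does not.
    desX-swap-adjacent : toℕ j ≡ suc (toℕ i) → desX R X (t ∘ τ) + X (suc (toℕ i)) ≈ desX R X τ
    desX-swap-adjacent j≡1+i = begin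
      desX R X (t ∘ τ) + X (suc (toℕ i))
        ≈⟨ +-congʳ (desX-as-sum m X (t ∘ τ)) ⟩
      sum {m} (descent X (t ∘ τ)) + X (suc (toℕ i))
        ≈⟨ sum-differ-at k₀ (descent X (t ∘ τ)) (descent X τ) _ at-k₀ elsewhere ⟩
      sum {m} (descent X τ)
        ≈⟨ sym (desX-as-sum m X τ) ⟩
      desX R X τ
        ∎
      where
      i<m : toℕ i < m
      i<m = ℕP.≤-pred (P.subst (_< suc m) j≡1+i (toℕ<n j))
      k₀ : Fin m
      k₀ = F.fromℕ< i<m
      k₀≡i : inject₁ k₀ ≡ i
      k₀≡i = toℕ-injective (P.trans (toℕ-inject₁ k₀) (toℕ-fromℕ< i<m))
      k₀+1≡j : F.suc k₀ ≡ j
      k₀+1≡j = toℕ-injective (P.trans (P.cong suc (toℕ-fromℕ< i<m)) (P.sym j≡1+i))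
      τ-at-k₀ : τ (inject₁ k₀) ≡ q⁺
      τ-at-k₀ = P.trans (P.cong τ k₀≡i) τi≡q⁺
      τ-at-k₀+1 : τ (F.suc k₀) ≡ q
      τ-at-k₀+1 = P.trans (P.cong τ k₀+1≡j) τj≡q
      at-k₀ : descent X (t ∘ τ) k₀ + X (suc (toℕ i)) ≈ descent X τ k₀
      at-k₀ = begin
        descent X (t ∘ τ) k₀ + X (suc (toℕ i))  ≈⟨ +-congʳ (𝟙-*-no (_ ℕ.<? _) _ swapped-ascent) ⟩
        0# + X (suc (toℕ i))                     ≈⟨ +-identityˡ _ ⟩
        X (suc (toℕ i))                          ≡⟨ P.cong (λ k → X (suc k)) (P.sym (toℕ-fromℕ< i<m)) ⟩
        X (suc (toℕ k₀))                         ≈⟨ sym (𝟙-*-yes (_ ℕ.<? _) _ original-descent) ⟩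
        descent X τ k₀                           ∎
        where
        swapped-ascent : ¬ (toℕ (t (τ (F.suc k₀))) < toℕ (t (τ (inject₁ k₀))))
        swapped-ascent lt =
          ℕP.<-asym (ℕP.n<1+n (toℕ q)) (P.subst₂ _<_ (P.trans (P.cong toℕ t-at-k₀+1) q⁺≡1+q) (P.cong toℕ t-at-k₀) lt)
          where
          t-at-k₀+1 : t (τ (F.suc k₀)) ≡ q⁺
          t-at-k₀+1 = P.trans (P.cong t τ-at-k₀+1) t-u
          t-at-k₀ : t (τ (inject₁ k₀)) ≡ q
          t-at-k₀ = P.trans (P.cong t τ-at-k₀) t-v
        original-descent : toℕ (τ (F.suc k₀)) < toℕ (τ (inject₁ k₀))
        original-descent =
          P.subst₂ _<_ (P.cong toℕ (P.sym τ-at-k₀+1)) (P.trans (P.sym q⁺≡1+q) (P.cong toℕ (P.sym τ-at-k₀)))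
                   (ℕP.n<1+n (toℕ q))
      elsewhere : ∀ k → k ≢ k₀ → descent X (t ∘ τ) k ≈ descent X τ k
      elsewhere k k≢k₀ = descent-unchanged k (no-ascent-pair i<j k) not-descent
        where
        i<j = P.subst (toℕ i <_) (P.sym j≡1+i) (ℕP.n<1+n (toℕ i))
        not-descent : ¬ (τ (inject₁ k) ≡ q⁺ × τ (F.suc k) ≡ q)
        not-descent (τk≡q⁺ , _) = k≢k₀ (toℕ-injective (P.trans (P.sym (toℕ-inject₁ k))
                                        (P.trans (P.cong toℕ (P.trans (at-i τk≡q⁺) (P.sym k₀≡i))) (toℕ-inject₁ k₀))))

module Exchange {c ℓ : Level} (R : CommutativeRing c ℓ) (m : ℕ) (X : ℕ → CommutativeRing.Carrier R) where
  open CommutativeRing R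
  open import Relation.Binary.Reasoning.Setoid setoid
  open RingSums R
  open FunctionSums R
  open InjectionSums R
  open PermutationSums R using (Weight; sumSab-as-sumInj)
  open Descents R
  open import Algebra.Properties.Group +-group using (quasigroup)
  open import Algebra.Properties.Quasigroup quasigroup using (x≈z//y)

  n : ℕ
  n = suc m

  Next : (b q : Fin n) → (Fin n → Fin n) → Carrier
  Next b q τ = 𝟙 (toℕ (τ b) ℕ.≟ suc (toℕ q)) * (X (suc (toℕ q)) * desX R X τ)

  Next-extensional : ∀ b q → Extensional (Next b q)
  Next-extensional b q f g f≗g = *-cong
    (𝟙-⇔ (P.trans (P.cong toℕ (P.sym (f≗g b)))) (P.trans (P.cong toℕ (f≗g b))) (_ ℕ.≟ _) (_ ℕ.≟ _))
    (*-congˡ (desX-extensional m X f g f≗g))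

  total : (a b : Fin n) → Carrier
  total a b = sumInj n n (Weight X a b)

  atValue : (a b q : Fin n) → Carrier
  atValue a b q = sumInj n n (λ τ → Pin a q τ * Next b q τ)

  -- Split by the value q = τ(a); the largest value has no successor.
  total-by-value : ∀ a b → total a b ≈ sum {m} (λ p → atValue a b (inject₁ p))
  total-by-value a b = begin
    sumInj n n (Weight X a b)
      ≈⟨ sumInj-cong n n by-value ⟩
    sumInj n n (λ τ → sum {n} (λ q → Pin a q τ * Next b q τ))
      ≈⟨ sumInj-sum n n (λ q τ → Pin a q τ * Next b q τ) ⟩
    sum {n} (atValue a b)
      ≈⟨ sum-init-last (atValue a b) ⟩
    sum {m} (λ p → atValue a b (inject₁ p)) + atValue a b (F.fromℕ m)
      ≈⟨ trans (+-congˡ last-vanishes) (+-identityʳ _) ⟩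
    sum {m} (λ p → atValue a b (inject₁ p))
      ∎
    where
    -- Weight X a b τ is Next b (τ a) τ
    by-value : ∀ τ → Weight X a b τ ≈ sum {n} (λ q → Pin a q τ * Next b q τ)
    by-value τ = sym (trans
      (sum-spike (τ a) (λ q → Pin a q τ * Next b q τ) (λ q q≢τa → 𝟙-*-no (τ a ≟ q) _ (λ e → q≢τa (P.sym e))))
      (𝟙-*-yes (τ a ≟ τ a) _ P.refl))
    last-vanishes : atValue a b (F.fromℕ m) ≈ 0#
    last-vanishes = sumInj-zero n n (λ τ → trans (*-congˡ (𝟙-*-no (_ ℕ.≟ _) _ (no-successor τ))) (zeroʳ _))
      where
      no-successor : ∀ τ → toℕ (τ b) ≢ suc (toℕ (F.fromℕ m))
      no-successor τ e = ℕP.<⇒≢ (toℕ<n (τ b)) (P.trans e (P.cong suc (toℕ-fromℕ m)))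

  module AtValue (p : Fin m) where
    q q⁺ : Fin n
    q  = inject₁ p
    q⁺ = F.suc p

    q⁺≡1+q : toℕ q⁺ ≡ suc (toℕ q)
    q⁺≡1+q = P.cong suc (P.sym (toℕ-inject₁ p))

    open AdjacentValues q q⁺ q⁺≡1+q public using (t; u≢v; t-to-u; t-to-v)

    swap : Permutation′ n
    swap = transpose q q⁺

    bothPinned : (i j : Fin n) (E : Carrier) → Carrier
    bothPinned i j E = sumInj n n (λ τ → Pin j q τ * (Pin i q⁺ τ * (X (suc (toℕ q)) * E)))

    DesXDrop : (i j : Fin n) (E : Carrier) → Set _
    DesXDrop i j E = ∀ τ → Injective τ → τ j ≡ q → τ i ≡ q⁺ → desX R X (t ∘ τ) + E ≈ desX R X τ

    exchange : ∀ (i j : Fin n) (E : Carrier) → DesXDrop i j E → atValue i j q + bothPinned i j E ≈ atValue j i q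
    exchange i j E desX-drop = begin
      atValue i j q + bothPinned i j E
        ≈⟨ +-congʳ (sumInj-relabel n swap (λ τ → Pin i q τ * Next j q τ) pinned-extensional) ⟩
      sumInj n n (λ τ → Pin i q (t ∘ τ) * Next j q (t ∘ τ)) + bothPinned i j E
        ≈⟨ sumInj-+ n n _ _ ⟩
      sumInj n n (λ τ → Pin i q (t ∘ τ) * Next j q (t ∘ τ) + Pin j q τ * (Pin i q⁺ τ * (Xq * E)))
        ≈⟨ sumInj-cong-injective n n pointwise ⟩
      atValue j i q
        ∎
      where
      Xq = X (suc (toℕ q))
      pinned-extensional : Extensional (λ τ → Pin i q τ * Next j q τ)
      pinned-extensional f g f≗g = *-cong (Pin-cong i q f g f≗g) (Next-extensional j q f g f≗g)
      pointwise : ∀ τ → Injective τ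
                → Pin i q (t ∘ τ) * Next j q (t ∘ τ) + Pin j q τ * (Pin i q⁺ τ * (Xq * E)) ≈ Pin j q τ * Next i q τ
      pointwise τ τ-injective = begin
        𝟙 (t (τ i) ≟ q) * (𝟙 (toℕ (t (τ j)) ℕ.≟ suc (toℕ q)) * (Xq * desX R X (t ∘ τ))) + B * (A * (Xq * E))
          ≈⟨ +-congʳ (*-cong swapped-i (*-congʳ swapped-j)) ⟩
        A * (B * (Xq * desX R X (t ∘ τ))) + B * (A * (Xq * E))
          ≈⟨ regroup A B Xq _ E ⟩
        B * (A * (Xq * (desX R X (t ∘ τ) + E)))
          ≈⟨ 𝟙-*-under (τ j ≟ q) (λ τj≡q → 𝟙-*-under (τ i ≟ q⁺) (λ τi≡q⁺ → *-congˡ (desX-drop τ τ-injective τj≡q τi≡q⁺))) ⟩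
        B * (A * (Xq * desX R X τ))
          ≈⟨ *-congˡ (*-congʳ q⁺-as-successor) ⟩
        Pin j q τ * Next i q τ
          ∎
        where
        open Equivalence
        A = Pin i q⁺ τ
        B = Pin j q τ
        swapped-i : 𝟙 (t (τ i) ≟ q) ≈ A
        swapped-i = 𝟙-⇔ (to (t-to-u (τ i))) (from (t-to-u (τ i))) (_ ≟ _) (_ ≟ _)
        -- toℕ (t y) = q + 1  iff  t y = q⁺  iff  y = q
        swapped-j : 𝟙 (toℕ (t (τ j)) ℕ.≟ suc (toℕ q)) ≈ B
        swapped-j = 𝟙-⇔ (λ e → to (t-to-v (τ j)) (toℕ-injective (P.trans e (P.sym q⁺≡1+q))))
                        (λ e → P.trans (P.cong toℕ (from (t-to-v (τ j)) e)) q⁺≡1+q) (_ ℕ.≟ _) (_ ≟ _)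
        q⁺-as-successor : A ≈ 𝟙 (toℕ (τ i) ℕ.≟ suc (toℕ q))
        q⁺-as-successor = 𝟙-⇔ (λ e → P.trans (P.cong toℕ e) q⁺≡1+q) (λ e → toℕ-injective (P.trans e (P.sym q⁺≡1+q)))
                              (τ i ≟ q⁺) (_ ℕ.≟ _)
        regroup : ∀ a b x D E → a * (b * (x * D)) + b * (a * (x * E)) ≈ b * (a * (x * (D + E)))
        regroup a b x D E = begin
          a * (b * (x * D)) + b * (a * (x * E))  ≈⟨ +-congʳ (*-exchange a b _) ⟩
          b * (a * (x * D)) + b * (a * (x * E))  ≈⟨ sym (distribˡ b _ _) ⟩
          b * (a * (x * D) + a * (x * E))        ≈⟨ *-congˡ (sym (distribˡ a _ _)) ⟩
          b * (a * (x * D + x * E))              ≈⟨ *-congˡ (*-congˡ (sym (distribˡ x _ _))) ⟩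
          b * (a * (x * (D + E)))                ∎

  open AtValue using (bothPinned; DesXDrop; exchange)

  exchange-total : ∀ (i j : Fin n) (E : Carrier) → (∀ p → DesXDrop p i j E)
                 → total i j + sum {m} (λ p → bothPinned p i j E) ≈ total j i
  exchange-total i j E desX-drop = begin
    total i j + sum {m} (λ p → bothPinned p i j E)
      ≈⟨ +-congʳ (total-by-value i j) ⟩
    sum {m} (λ p → atValue i j (inject₁ p)) + sum {m} (λ p → bothPinned p i j E)
      ≈⟨ sym (∑-distrib-+ {m} _ _) ⟩
    sum {m} (λ p → atValue i j (inject₁ p) + bothPinned p i j E)
      ≈⟨ sum-cong {m} (λ p → exchange p i j E (desX-drop p)) ⟩
    sum {m} (λ p → atValue j i (inject₁ p))
      ≈⟨ sym (total-by-value j i) ⟩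
    total j i
      ∎

  total-far : ∀ (i j : Fin n) → suc (toℕ i) < toℕ j → total i j ≈ total j i
  total-far i j 1+i<j = begin
    total i j
      ≈⟨ sym (+-identityʳ _) ⟩
    total i j + 0#
      ≈⟨ +-congˡ (sym (sum-zero {m} (λ p → sumInj-zero n n (λ τ → no-weight)))) ⟩
    total i j + sum {m} (λ p → bothPinned p i j 0#)
      ≈⟨ exchange-total i j 0# desX-unchanged ⟩
    total j i
      ∎
    where
    no-weight : ∀ {A B Y} → A * (B * (Y * 0#)) ≈ 0#
    no-weight = trans (*-congˡ (*-congˡ (zeroʳ _))) (trans (*-congˡ (zeroʳ _)) (zeroʳ _))
    desX-unchanged : ∀ p → DesXDrop p i j 0#
    desX-unchanged p τ τ-inj τj≡q τi≡q⁺ =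
      trans (+-identityʳ _) (SwapValues.desX-swap-far X _ _ (AtValue.q⁺≡1+q p) τ τ-inj i j τj≡q τi≡q⁺ 1+i<j)

  -- j = i+1: the exchange loses X_{i+1} on the (n-2)! injections pinned at each value.
  total-adjacent : ∀ (i j : Fin n) → toℕ j ≡ suc (toℕ i)
                 → total i j + ((n ∸ 2) !) ⨯ (X (suc (toℕ i)) * sum {m} (λ k → X (suc (toℕ k)))) ≈ total j i
  total-adjacent i j j≡1+i = trans (+-congˡ correction) (exchange-total i j Xi desX-drop)
    where
    Xi = X (suc (toℕ i))
    j≢i : j ≢ i
    j≢i j≡i = ℕP.1+n≢n (P.trans (P.sym j≡1+i) (P.cong toℕ j≡i))
    desX-drop : ∀ p → DesXDrop p i j Xi
    desX-drop p τ τ-inj τj≡q τi≡q⁺ =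
      SwapValues.desX-swap-adjacent X _ _ (AtValue.q⁺≡1+q p) τ τ-inj i j τj≡q τi≡q⁺ j≡1+i
    pinned-count : ∀ p → bothPinned p i j Xi ≈ ((n ∸ 2) !) ⨯ (Xi * X (suc (toℕ p)))
    pinned-count p = trans (count-injections-pin₂ n _ j i (AtValue.q p) (AtValue.q⁺ p) j≢i (AtValue.u≢v p))
      (×-congʳ ((n ∸ 2) !) (trans (*-comm _ _) (*-congˡ (reflexive (P.cong (λ k → X (suc k)) (toℕ-inject₁ p))))))
    correction : ((n ∸ 2) !) ⨯ (Xi * sum {m} (λ k → X (suc (toℕ k)))) ≈ sum {m} (λ p → bothPinned p i j Xi)
    correction = begin
      ((n ∸ 2) !) ⨯ (Xi * sum {m} (λ k → X (suc (toℕ k))))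
        ≈⟨ ×-congʳ ((n ∸ 2) !) (*-distribˡ-sum {m} Xi (λ k → X (suc (toℕ k)))) ⟩
      ((n ∸ 2) !) ⨯ sum {m} (λ k → Xi * X (suc (toℕ k)))
        ≈⟨ ×-distrib-sum {m} ((n ∸ 2) !) (λ k → Xi * X (suc (toℕ k))) ⟩
      sum {m} (λ k → ((n ∸ 2) !) ⨯ (Xi * X (suc (toℕ k))))
        ≈⟨ sum-cong {m} (λ p → sym (pinned-count p)) ⟩
      sum {m} (λ p → bothPinned p i j Xi)
        ∎

  sumSab-far : ∀ (i j : Fin n) → suc (toℕ i) < toℕ j → sumSab R n X i j ≈ sumSab R n X j i
  sumSab-far i j 1+i<j = begin
    sumSab R n X i j   ≈⟨ sumSab-as-sumInj n X i j ⟩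
    total i j          ≈⟨ total-far i j 1+i<j ⟩
    total j i          ≈⟨ sym (sumSab-as-sumInj n X j i) ⟩
    sumSab R n X j i   ∎

  sumSab-adjacent : ∀ (i j : Fin n) → toℕ j ≡ suc (toℕ i)
                  → sumSab R n X i j ≈ sumSab R n X j i - _·ℕ_ R ((n ∸ 2) !) (X (suc (toℕ i)) * dn R n X)
  sumSab-adjacent i j j≡1+i = begin
    sumSab R n X i j   ≈⟨ sumSab-as-sumInj n X i j ⟩
    total i j          ≈⟨ x≈z//y _ _ _ (total-adjacent i j j≡1+i) ⟩
    total j i - ((n ∸ 2) !) ⨯ (X (suc (toℕ i)) * sum {m} (λ k → X (suc (toℕ k))))
      ≈⟨ +-cong (sym (sumSab-as-sumInj n X j i)) (-‿cong (sym correction-in-Defs)) ⟩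
    sumSab R n X j i - _·ℕ_ R ((n ∸ 2) !) (X (suc (toℕ i)) * dn R n X)
      ∎
    where
    correction-in-Defs : _·ℕ_ R ((n ∸ 2) !) (X (suc (toℕ i)) * dn R n X)
                       ≈ ((n ∸ 2) !) ⨯ (X (suc (toℕ i)) * sum {m} (λ k → X (suc (toℕ k))))
    correction-in-Defs = trans (·ℕ≈× ((n ∸ 2) !) (X (suc (toℕ i)) * dn R n X))
                               (×-congʳ ((n ∸ 2) !) (*-congˡ (sumR-allFin {m} (λ k → X (suc (toℕ k))))))

-- Lemma 3.1.  The argument works for every n ≥ 1; the hypothesis 3 ≤ n only
-- excludes n = 0 here.
lemma3p1 : ∀ {c ℓ : Level} (R : CommutativeRing c ℓ) (X : ℕ → CommutativeRing.Carrier R)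
    (n : ℕ) → 3 ≤ n → (i j : Fin n) →
    (suc (toℕ i) < toℕ j →
    CommutativeRing._≈_ R (sumSab R n X i j) (sumSab R n X j i))
    × (toℕ j ≡ suc (toℕ i) →
    CommutativeRing._≈_ R (sumSab R n X i j)
    (CommutativeRing._-_ R (sumSab R n X j i)
    (_·ℕ_ R ((n ∸ 2) !) (CommutativeRing._*_ R (X (suc (toℕ i))) (dn R n X)))))
lemma3p1 R X (suc m) _ i j = sumSab-far i j , sumSab-adjacent i j
  where
  open Exchange R m X
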